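{- Let $n$ be a square free positive integer and let $N,M$ be ternary $\mathbb{Z}$-lattices such that $([N],[M])$ is a representable pair by scaling $n$. Then for any prime $p$ dividing $n$ there is a ternary $\mathbb{Z}$-lattice $N(p)$ such that $([N],[N(p)])$ is a representable pair by scaling $p$ and $([N(p)],[M])$ is a representable pair by scaling $n/p$.
   Context: Lattices are positive definite ternary $\mathbb{Z}$-lattices with $\mathfrak n(L)\subseteq\mathbb{Z}$, bilinear form $B$, $Q(x)=B(x,x)$; $L^a$ is $L$ with bilinear form scaled by $a$; $[L]$ is the isometry class. $([N],[M])$ is a representable pair by scaling $n$ if there is an isometric embedding $\phi:M^n\to N$ with $[N:\phi(M^n)]=n$. -}

module Defs where

open import Data.Nat as ℕ using (ℕ)
open import Data.Nat.Divisibility as ℕD using ()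
open import Data.Integer using (ℤ; +_; _+_; _*_; _-_; ∣_∣; _<_; +0)
open import Data.Integer.Divisibility using () renaming (_∣_ to _∣ℤ_)
open import Data.Fin using (Fin; zero; suc)
open import Data.Product using (Σ; ∃; _×_)
open import Relation.Binary.PropositionalEquality using (_≡_)
open import Relation.Nullary using (¬_)

Vec3 : Set
Vec3 = Fin 3 → ℤ

Mat3 : Set
Mat3 = Fin 3 → Fin 3 → ℤ

i0 i1 i2 : Fin 3
i0 = zero
i1 = suc zero
i2 = suc (suc zero)

sum3 : (Fin 3 → ℤ) → ℤ
sum3 f = f i0 + f i1 + f i2

_⊗_ : Mat3 → Mat3 → Mat3
(A ⊗ B) i j = sum3 (λ k → A i k * B k j)

transpose : Mat3 → Mat3
transpose A i j = A j i

scaleM : ℤ → Mat3 → Mat3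
scaleM c A i j = c * A i j

det3 : Mat3 → ℤ
det3 A =
    A i0 i0 * (A i1 i1 * A i2 i2 - A i1 i2 * A i2 i1)
  - A i0 i1 * (A i1 i0 * A i2 i2 - A i1 i2 * A i2 i0)
  + A i0 i2 * (A i1 i0 * A i2 i1 - A i1 i1 * A i2 i0)

qform : Mat3 → Vec3 → ℤ
qform A x = sum3 (λ i → sum3 (λ j → x i * A i j * x j))

-- The field 'gram2' is the Gram matrix of 2B (i.e. 2 B(e_i,e_j)), so that
-- 'gram2' has integer entries (B takes values in ½ℤ since n(L) ⊆ ℤ) and
-- Q(x) = B(x,x) = ½ x^T gram2 x.  n(L) ⊆ ℤ ⇔ the diagonal of gram2 is even.
record TernaryLattice : Set where
  field
    gram2    : Mat3
    symm     : ∀ i j → gram2 i j ≡ gram2 j i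
    evenDiag : ∀ i → (+ 2) ∣ℤ gram2 i i
    posDef   : ∀ (x : Vec3) → ¬ (∀ i → x i ≡ +0) → +0 < qform gram2 x
open TernaryLattice public

-- ([N],[M]) is a representable pair by scaling n: there is an isometric
-- embedding φ : M^n → N with [N : φ(M^n)] = n.  In coordinates, φ is given
-- by an integer matrix T (column j = coordinates of φ(e_j) in the basis of N);
-- φ is an isometry from M^n iff T^T G_N T = n G_M, and the index of the image
-- is |det T|.  (Injectivity is automatic from positive definiteness.)
RepPairByScaling : TernaryLattice → TernaryLattice → ℕ → Set
RepPairByScaling N M n =
  Σ Mat3 λ T →
    (∀ i j → (transpose T ⊗ (gram2 N ⊗ T)) i j ≡ scaleM (+ n) (gram2 M) i j)
    × ∣ det3 T ∣ ≡ n

SquareFree : ℕ → Set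
SquareFree n = ∀ (d : ℕ) → d ℕ.* d ℕD.∣ n → d ≡ 1

{-# OPTIONS --safe #-}
module Submission where

-- Write the embedding as an integer matrix T with Tᵀ G_N T = n G_M and |det T| = n = pq,
-- where p ∤ q as n is square-free.  Then p³ ∤ (det T)² = det (adj T), so some entry of
-- adj T is prime to p, and the corresponding row of adj T is a left kernel vector of T
-- modulo p that can be normalised to have an entry 1.  A unimodular row operation thus
-- makes one row of T divisible by p, giving T = S U with |det S| = p and |det U| = q.
--
-- Let P = Sᵀ G_N S and X = (adj U)ᵀ G_M (adj U).  Since T adj U = (det U) S, the Gram
-- matrix of T adj U is both (det U)² P = q² P and pq X; hence q P = p X and, as p ∤ q,
-- P = p C for an integral C.  C is the Gram matrix of N(p): S embeds N(p)^p into N and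
-- U embeds M^q into N(p).  C is positive definite since p C[x] = G_N[S x], and its
-- diagonal is even because P = p C and X = q C have even diagonals while p or q is odd.

open import Defs
open import Data.Nat using (ℕ; _*_; _>_)
open import Data.Nat.Primality using (Prime)
open import Data.Product using (Σ; _×_)
open import Relation.Binary.PropositionalEquality using (_≡_)

open import Data.Empty using (⊥-elim)
open import Data.Fin.Base using (Fin; zero; suc)
open import Data.Fin.Properties using (¬∀⟶∃¬; all?) renaming (_≟_ to _≟ᶠ_)
open import Data.Integer.Base as ℤ using (ℤ; +_; 0ℤ; 1ℤ; ∣_∣)
open import Data.Integer.Divisibility.Signed
  using (_∣_; divides; quotient; _∣?_; ∣ᵤ⇒∣; ∣⇒∣ᵤ; ∣m∣n⇒∣m+n; ∣m⇒∣m*n; ∣n⇒∣m*n)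
open import Data.Integer.Tactic.RingSolver using (solve-∀)
open import Data.Nat.Coprimality using (Coprime; coprime-Bézout; coprime-divisor; coprime-factors)
open import Data.Nat.GCD using (module Bézout)
open import Data.Nat.Primality using (prime⇒irreducible; prime⇒nonZero; euclidsLemma; ¬prime[1])
open import Data.Product.Base using (_,_; ∃; ∃₂)
open import Data.Sum.Base using (inj₁; inj₂; fromInj₂; reduce)
open import Data.Vec.Functional using (updateAt)
open import Data.Vec.Functional.Properties using (updateAt-updates; updateAt-minimal)
open import Level using (0ℓ)
open import Relation.Binary.Bundles using (Setoid)
open import Relation.Binary.Core using (Rel)
open import Relation.Binary.PropositionalEquality
  using (_≢_; refl; sym; trans; cong; cong₂; subst; subst₂; module ≡-Reasoning)
import Relation.Binary.Reasoning.Setoid as SetoidReasoning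
open import Relation.Nullary.Decidable using (yes; no)
open import Relation.Nullary.Negation using (¬_)
import Data.Integer.Properties as ℤ
import Data.Nat.Base as ℕ
import Data.Nat.Divisibility as ℕ
import Data.Nat.Properties as ℕ
import Data.Nat.Tactic.RingSolver as ℕ
open import Algebra.Properties.CommutativeSemigroup ℤ.*-commutativeSemigroup using (x∙yz≈y∙xz; xy∙z≈y∙xz)

infix 4 _≈_
_≈_ : Rel Mat3 0ℓ
A ≈ B = ∀ i j → A i j ≡ B i j

≈-setoid : Setoid 0ℓ 0ℓ
≈-setoid = record
  { _≈_ = _≈_
  ; isEquivalence = record
    { refl = λ _ _ → refl
    ; sym = λ A≈B i j → sym (A≈B i j)
    ; trans = λ A≈B B≈C i j → trans (A≈B i j) (B≈C i j)
    }
  }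

open Setoid ≈-setoid using () renaming (refl to ≈-refl; sym to ≈-sym; trans to ≈-trans)
module ≈-Reasoning = SetoidReasoning ≈-setoid

sum3-cong : ∀ {f g : Vec3} → (∀ k → f k ≡ g k) → sum3 f ≡ sum3 g
sum3-cong f≗g = cong₂ ℤ._+_ (cong₂ ℤ._+_ (f≗g i0) (f≗g i1)) (f≗g i2)

sum3-*ˡ : ∀ c (f : Vec3) → c ℤ.* sum3 f ≡ sum3 (λ k → c ℤ.* f k)
sum3-*ˡ c f = trans (ℤ.*-distribˡ-+ c (f i0 ℤ.+ f i1) (f i2)) (cong (ℤ._+ c ℤ.* f i2) (ℤ.*-distribˡ-+ c (f i0) (f i1)))

sum3-*ʳ : ∀ (f : Vec3) c → sum3 f ℤ.* c ≡ sum3 (λ k → f k ℤ.* c)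
sum3-*ʳ f c = trans (ℤ.*-distribʳ-+ c (f i0 ℤ.+ f i1) (f i2)) (cong (ℤ._+ f i2 ℤ.* c) (ℤ.*-distribʳ-+ c (f i0) (f i1)))

sum3-swap : ∀ (f : Mat3) → sum3 (λ k → sum3 (f k)) ≡ sum3 (λ l → sum3 (λ k → f k l))
sum3-swap f = identity (f i0 i0) (f i0 i1) (f i0 i2) (f i1 i0) (f i1 i1) (f i1 i2) (f i2 i0) (f i2 i1) (f i2 i2)
  where
  identity : ∀ a b c d e f g h i →
    (a ℤ.+ b ℤ.+ c) ℤ.+ (d ℤ.+ e ℤ.+ f) ℤ.+ (g ℤ.+ h ℤ.+ i) ≡ (a ℤ.+ d ℤ.+ g) ℤ.+ (b ℤ.+ e ℤ.+ h) ℤ.+ (c ℤ.+ f ℤ.+ i)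
  identity = solve-∀

1M : ∀ {n} → Fin n → Fin n → ℤ
1M zero    zero    = 1ℤ
1M zero    (suc _) = 0ℤ
1M (suc _) zero    = 0ℤ
1M (suc i) (suc j) = 1M i j

1M-diagonal : ∀ {n} (k : Fin n) → 1M k k ≡ 1ℤ
1M-diagonal zero    = refl
1M-diagonal (suc k) = 1M-diagonal k

1M-sym : ∀ {n} (i j : Fin n) → 1M i j ≡ 1M j i
1M-sym zero    zero    = refl
1M-sym zero    (suc _) = refl
1M-sym (suc _) zero    = refl
1M-sym (suc i) (suc j) = 1M-sym i j

column : Mat3 → Fin 3 → Vec3
column A j i = A i j

dot : Vec3 → Vec3 → ℤ
dot u v = sum3 (λ k → u k ℤ.* v k)

dot-1M : ∀ i (v : Vec3) → dot (1M i) v ≡ v i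
dot-1M zero          v = identity (v i0) (v i1) (v i2)
  where
  identity : ∀ a b c → 1ℤ ℤ.* a ℤ.+ 0ℤ ℤ.* b ℤ.+ 0ℤ ℤ.* c ≡ a
  identity = solve-∀
dot-1M (suc zero)    v = identity (v i0) (v i1) (v i2)
  where
  identity : ∀ a b c → 0ℤ ℤ.* a ℤ.+ 1ℤ ℤ.* b ℤ.+ 0ℤ ℤ.* c ≡ b
  identity = solve-∀
dot-1M (suc (suc zero)) v = identity (v i0) (v i1) (v i2)
  where
  identity : ∀ a b c → 0ℤ ℤ.* a ℤ.+ 0ℤ ℤ.* b ℤ.+ 1ℤ ℤ.* c ≡ c
  identity = solve-∀

dot-comm : ∀ u v → dot u v ≡ dot v u
dot-comm u v = sum3-cong (λ k → ℤ.*-comm (u k) (v k))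

dot-linear : ∀ a b x y t → dot (λ l → a ℤ.* x l ℤ.+ b ℤ.* y l) t ≡ a ℤ.* dot x t ℤ.+ b ℤ.* dot y t
dot-linear a b x y t = identity a b (x i0) (x i1) (x i2) (y i0) (y i1) (y i2) (t i0) (t i1) (t i2)
  where
  identity : ∀ a b x₀ x₁ x₂ y₀ y₁ y₂ t₀ t₁ t₂ →
    let dot = λ u₀ u₁ u₂ → u₀ ℤ.* t₀ ℤ.+ u₁ ℤ.* t₁ ℤ.+ u₂ ℤ.* t₂
    in dot (a ℤ.* x₀ ℤ.+ b ℤ.* y₀) (a ℤ.* x₁ ℤ.+ b ℤ.* y₁) (a ℤ.* x₂ ℤ.+ b ℤ.* y₂)
       ≡ a ℤ.* dot x₀ x₁ x₂ ℤ.+ b ℤ.* dot y₀ y₁ y₂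
  identity = solve-∀

⊗-identityˡ : ∀ A → 1M ⊗ A ≈ A
⊗-identityˡ A i j = dot-1M i (column A j)

⊗-identityʳ : ∀ A → A ⊗ 1M ≈ A
⊗-identityʳ A i j = begin
  dot (A i) (column 1M j)  ≡⟨ sum3-cong (λ k → cong (A i k ℤ.*_) (1M-sym k j)) ⟩
  dot (A i) (1M j)         ≡⟨ dot-comm (A i) (1M j) ⟩
  dot (1M j) (A i)         ≡⟨ dot-1M j (A i) ⟩
  A i j                    ∎
  where open ≡-Reasoning

⊗-cong : ∀ {A A′ B B′} → A ≈ A′ → B ≈ B′ → A ⊗ B ≈ A′ ⊗ B′
⊗-cong A≈A′ B≈B′ i j = sum3-cong (λ k → cong₂ ℤ._*_ (A≈A′ i k) (B≈B′ k j))

⊗-congˡ : ∀ {A A′} B → A ≈ A′ → A ⊗ B ≈ A′ ⊗ B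
⊗-congˡ B A≈A′ = ⊗-cong A≈A′ (≈-refl {B})

⊗-congʳ : ∀ A {B B′} → B ≈ B′ → A ⊗ B ≈ A ⊗ B′
⊗-congʳ A = ⊗-cong (≈-refl {A})

transpose-cong : ∀ {A B} → A ≈ B → transpose A ≈ transpose B
transpose-cong A≈B i j = A≈B j i

scaleM-cong : ∀ c {A B} → A ≈ B → scaleM c A ≈ scaleM c B
scaleM-cong c A≈B i j = cong (c ℤ.*_) (A≈B i j)

⊗-assoc : ∀ A B C → (A ⊗ B) ⊗ C ≈ A ⊗ (B ⊗ C)
⊗-assoc A B C i j = begin
  sum3 (λ k → sum3 (λ l → A i l ℤ.* B l k) ℤ.* C k j)
    ≡⟨ sum3-cong (λ k → trans (sum3-*ʳ (λ l → A i l ℤ.* B l k) (C k j))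
                              (sum3-cong (λ l → ℤ.*-assoc (A i l) (B l k) (C k j)))) ⟩
  sum3 (λ k → sum3 (λ l → A i l ℤ.* (B l k ℤ.* C k j)))
    ≡⟨ sum3-swap (λ k l → A i l ℤ.* (B l k ℤ.* C k j)) ⟩
  sum3 (λ l → sum3 (λ k → A i l ℤ.* (B l k ℤ.* C k j)))
    ≡⟨ sum3-cong (λ l → sym (sum3-*ˡ (A i l) (λ k → B l k ℤ.* C k j))) ⟩
  sum3 (λ l → A i l ℤ.* sum3 (λ k → B l k ℤ.* C k j))
    ∎
  where open ≡-Reasoning

transpose-⊗ : ∀ A B → transpose (A ⊗ B) ≈ transpose B ⊗ transpose A
transpose-⊗ A B i j = sum3-cong (λ k → ℤ.*-comm (A j k) (B k i))

scaleM-⊗ : ∀ c A B → scaleM c A ⊗ B ≈ scaleM c (A ⊗ B)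
scaleM-⊗ c A B i j = trans (sum3-cong (λ k → ℤ.*-assoc c (A i k) (B k j))) (sym (sum3-*ˡ c (λ k → A i k ℤ.* B k j)))

⊗-scaleM : ∀ c A B → A ⊗ scaleM c B ≈ scaleM c (A ⊗ B)
⊗-scaleM c A B i j = trans (sum3-cong (λ k → x∙yz≈y∙xz (A i k) c (B k j))) (sym (sum3-*ˡ c (λ k → A i k ℤ.* B k j)))

scaleM-scaleM : ∀ c d A → scaleM c (scaleM d A) ≈ scaleM (c ℤ.* d) A
scaleM-scaleM c d A i j = sym (ℤ.*-assoc c d (A i j))

infixl 8 _⟦_⟧
_⟦_⟧ : Mat3 → Mat3 → Mat3
G ⟦ A ⟧ = transpose A ⊗ (G ⊗ A)

⟦⟧-congˡ : ∀ {G G′} A → G ≈ G′ → G ⟦ A ⟧ ≈ G′ ⟦ A ⟧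
⟦⟧-congˡ A G≈G′ = ⊗-congʳ (transpose A) (⊗-congˡ A G≈G′)

⟦⟧-congʳ : ∀ G {A A′} → A ≈ A′ → G ⟦ A ⟧ ≈ G ⟦ A′ ⟧
⟦⟧-congʳ G A≈A′ = ⊗-cong (transpose-cong A≈A′) (⊗-congʳ G A≈A′)

⟦⟧-⊗ : ∀ G A B → G ⟦ A ⊗ B ⟧ ≈ G ⟦ A ⟧ ⟦ B ⟧
⟦⟧-⊗ G A B = begin
  transpose (A ⊗ B) ⊗ (G ⊗ (A ⊗ B))             ≈⟨ ⊗-congˡ (G ⊗ (A ⊗ B)) (transpose-⊗ A B) ⟩
  (transpose B ⊗ transpose A) ⊗ (G ⊗ (A ⊗ B))   ≈⟨ ⊗-assoc (transpose B) (transpose A) (G ⊗ (A ⊗ B)) ⟩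
  transpose B ⊗ (transpose A ⊗ (G ⊗ (A ⊗ B)))   ≈⟨ ⊗-congʳ (transpose B) (⊗-congʳ (transpose A) (⊗-assoc G A B)) ⟨
  transpose B ⊗ (transpose A ⊗ ((G ⊗ A) ⊗ B))   ≈⟨ ⊗-congʳ (transpose B) (⊗-assoc (transpose A) (G ⊗ A) B) ⟨
  transpose B ⊗ ((transpose A ⊗ (G ⊗ A)) ⊗ B)   ∎
  where open ≈-Reasoning

⟦⟧-scaleˡ : ∀ c G A → scaleM c G ⟦ A ⟧ ≈ scaleM c (G ⟦ A ⟧)
⟦⟧-scaleˡ c G A = ≈-trans (⊗-congʳ (transpose A) (scaleM-⊗ c G A)) (⊗-scaleM c (transpose A) (G ⊗ A))

⟦⟧-scaleʳ : ∀ c G A → G ⟦ scaleM c A ⟧ ≈ scaleM (c ℤ.* c) (G ⟦ A ⟧)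
⟦⟧-scaleʳ c G A = begin
  scaleM c (transpose A) ⊗ (G ⊗ scaleM c A)   ≈⟨ scaleM-⊗ c (transpose A) (G ⊗ scaleM c A) ⟩
  scaleM c (transpose A ⊗ (G ⊗ scaleM c A))   ≈⟨ scaleM-cong c (⊗-congʳ (transpose A) (⊗-scaleM c G A)) ⟩
  scaleM c (transpose A ⊗ scaleM c (G ⊗ A))   ≈⟨ scaleM-cong c (⊗-scaleM c (transpose A) (G ⊗ A)) ⟩
  scaleM c (scaleM c (G ⟦ A ⟧))               ≈⟨ scaleM-scaleM c c (G ⟦ A ⟧) ⟩
  scaleM (c ℤ.* c) (G ⟦ A ⟧)                  ∎
  where open ≈-Reasoning

transpose-⟦⟧ : ∀ G A → transpose (G ⟦ A ⟧) ≈ transpose G ⟦ A ⟧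
transpose-⟦⟧ G A = begin
  transpose (transpose A ⊗ (G ⊗ A))   ≈⟨ transpose-⊗ (transpose A) (G ⊗ A) ⟩
  transpose (G ⊗ A) ⊗ A               ≈⟨ ⊗-congˡ A (transpose-⊗ G A) ⟩
  (transpose A ⊗ transpose G) ⊗ A     ≈⟨ ⊗-assoc (transpose A) (transpose G) A ⟩
  transpose A ⊗ (transpose G ⊗ A)     ∎
  where open ≈-Reasoning

-- Cross products, adjugates and determinants

next : Fin 3 → Fin 3
next zero             = suc zero
next (suc zero)       = suc (suc zero)
next (suc (suc zero)) = zero

cross : Vec3 → Vec3 → Vec3
cross u v k = u (next k) ℤ.* v (next (next k)) ℤ.- u (next (next k)) ℤ.* v (next k)

-- With cyclic indices no cofactor signs are needed: column j of adj A is the cross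
-- product of rows j + 1 and j + 2 of A.
adj : Mat3 → Mat3
adj A i j = cross (A (next j)) (A (next (next j))) i

dot-cross-rotate : ∀ u v w → dot u (cross v w) ≡ dot v (cross w u)
dot-cross-rotate u v w = identity (u i0) (u i1) (u i2) (v i0) (v i1) (v i2) (w i0) (w i1) (w i2)
  where
  identity : ∀ a b c d e f g h i →
    let triple = λ x₀ x₁ x₂ y₀ y₁ y₂ z₀ z₁ z₂ →
          x₀ ℤ.* (y₁ ℤ.* z₂ ℤ.- y₂ ℤ.* z₁) ℤ.+ x₁ ℤ.* (y₂ ℤ.* z₀ ℤ.- y₀ ℤ.* z₂) ℤ.+ x₂ ℤ.* (y₀ ℤ.* z₁ ℤ.- y₁ ℤ.* z₀)
    in triple a b c d e f g h i ≡ triple d e f g h i a b c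
  identity = solve-∀

dot-cross-selfˡ : ∀ u v → dot u (cross u v) ≡ 0ℤ
dot-cross-selfˡ u v = identity (u i0) (u i1) (u i2) (v i0) (v i1) (v i2)
  where
  identity : ∀ a b c d e f →
    a ℤ.* (b ℤ.* f ℤ.- c ℤ.* e) ℤ.+ b ℤ.* (c ℤ.* d ℤ.- a ℤ.* f) ℤ.+ c ℤ.* (a ℤ.* e ℤ.- b ℤ.* d) ≡ 0ℤ
  identity = solve-∀

dot-cross-selfʳ : ∀ u v → dot v (cross u v) ≡ 0ℤ
dot-cross-selfʳ u v = trans (dot-cross-rotate v u v) (trans (dot-cross-rotate u v v) (dot-cross-selfˡ v u))

det3-rows : ∀ A → det3 A ≡ dot (A i0) (cross (A i1) (A i2))
det3-rows A = identity (A i0 i0) (A i0 i1) (A i0 i2) (A i1 i0) (A i1 i1) (A i1 i2) (A i2 i0) (A i2 i1) (A i2 i2)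
  where
  identity : ∀ a b c d e f g h i →
    a ℤ.* (e ℤ.* i ℤ.- f ℤ.* h) ℤ.- b ℤ.* (d ℤ.* i ℤ.- f ℤ.* g) ℤ.+ c ℤ.* (d ℤ.* h ℤ.- e ℤ.* g)
    ≡ a ℤ.* (e ℤ.* i ℤ.- f ℤ.* h) ℤ.+ b ℤ.* (f ℤ.* g ℤ.- d ℤ.* i) ℤ.+ c ℤ.* (d ℤ.* h ℤ.- e ℤ.* g)
  identity = solve-∀

⊗-adj : ∀ A → A ⊗ adj A ≈ scaleM (det3 A) 1M
⊗-adj A = entry
  where
  on-diagonal : ∀ {x} → x ≡ det3 A → x ≡ det3 A ℤ.* 1ℤ
  on-diagonal x≡det = trans x≡det (sym (ℤ.*-identityʳ (det3 A)))

  off-diagonal : ∀ {x} → x ≡ 0ℤ → x ≡ det3 A ℤ.* 0ℤ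
  off-diagonal x≡0 = trans x≡0 (sym (ℤ.*-zeroʳ (det3 A)))

  rotate₁ : det3 A ≡ dot (A i1) (cross (A i2) (A i0))
  rotate₁ = trans (det3-rows A) (dot-cross-rotate (A i0) (A i1) (A i2))

  rotate₂ : det3 A ≡ dot (A i2) (cross (A i0) (A i1))
  rotate₂ = trans rotate₁ (dot-cross-rotate (A i1) (A i2) (A i0))

  entry : A ⊗ adj A ≈ scaleM (det3 A) 1M
  entry zero             zero             = on-diagonal (sym (det3-rows A))
  entry (suc zero)       (suc zero)       = on-diagonal (sym rotate₁)
  entry (suc (suc zero)) (suc (suc zero)) = on-diagonal (sym rotate₂)
  entry zero             (suc zero)       = off-diagonal (dot-cross-selfʳ (A i2) (A i0))
  entry zero             (suc (suc zero)) = off-diagonal (dot-cross-selfˡ (A i0) (A i1))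
  entry (suc zero)       zero             = off-diagonal (dot-cross-selfˡ (A i1) (A i2))
  entry (suc zero)       (suc (suc zero)) = off-diagonal (dot-cross-selfʳ (A i0) (A i1))
  entry (suc (suc zero)) zero             = off-diagonal (dot-cross-selfʳ (A i1) (A i2))
  entry (suc (suc zero)) (suc zero)       = off-diagonal (dot-cross-selfˡ (A i2) (A i0))

adj-transpose : ∀ A → adj (transpose A) ≈ transpose (adj A)
adj-transpose A i j = cong (ℤ._-_ (A (next i) (next j) ℤ.* A (next (next i)) (next (next j))))
                           (ℤ.*-comm (A (next (next i)) (next j)) (A (next i) (next (next j))))

det3-transpose : ∀ A → det3 (transpose A) ≡ det3 A
det3-transpose A = identity (A i0 i0) (A i0 i1) (A i0 i2) (A i1 i0) (A i1 i1) (A i1 i2) (A i2 i0) (A i2 i1) (A i2 i2)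
  where
  identity : ∀ a b c d e f g h i →
    let det = λ a b c d e f g h i →
          a ℤ.* (e ℤ.* i ℤ.- f ℤ.* h) ℤ.- b ℤ.* (d ℤ.* i ℤ.- f ℤ.* g) ℤ.+ c ℤ.* (d ℤ.* h ℤ.- e ℤ.* g)
    in det a d g b e h c f i ≡ det a b c d e f g h i
  identity = solve-∀

adj-⊗ : ∀ A → adj A ⊗ A ≈ scaleM (det3 A) 1M
adj-⊗ A = begin
  adj A ⊗ A                                     ≈⟨ transpose-⊗ (transpose A) (transpose (adj A)) ⟨
  transpose (transpose A ⊗ transpose (adj A))   ≈⟨ transpose-cong (⊗-congʳ (transpose A) (adj-transpose A)) ⟨
  transpose (transpose A ⊗ adj (transpose A))   ≈⟨ transpose-cong (⊗-adj (transpose A)) ⟩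
  transpose (scaleM (det3 (transpose A)) 1M)    ≈⟨ (λ i j → cong₂ ℤ._*_ (det3-transpose A) (1M-sym j i)) ⟩
  scaleM (det3 A) 1M                            ∎
  where open ≈-Reasoning

det3-cong : ∀ {A B} → A ≈ B → det3 A ≡ det3 B
det3-cong A≈B
  rewrite A≈B i0 i0 | A≈B i0 i1 | A≈B i0 i2 | A≈B i1 i0 | A≈B i1 i1 | A≈B i1 i2 | A≈B i2 i0 | A≈B i2 i1 | A≈B i2 i2
  = refl

det3-⊗ : ∀ A B → det3 (A ⊗ B) ≡ det3 A ℤ.* det3 B
det3-⊗ A B = identity (A i0 i0) (A i0 i1) (A i0 i2) (A i1 i0) (A i1 i1) (A i1 i2) (A i2 i0) (A i2 i1) (A i2 i2)
                      (B i0 i0) (B i0 i1) (B i0 i2) (B i1 i0) (B i1 i1) (B i1 i2) (B i2 i0) (B i2 i1) (B i2 i2)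
  where
  identity : ∀ a b c d e f g h i a′ b′ c′ d′ e′ f′ g′ h′ i′ →
    let det = λ a b c d e f g h i →
          a ℤ.* (e ℤ.* i ℤ.- f ℤ.* h) ℤ.- b ℤ.* (d ℤ.* i ℤ.- f ℤ.* g) ℤ.+ c ℤ.* (d ℤ.* h ℤ.- e ℤ.* g)
        dot = λ x y z x′ y′ z′ → x ℤ.* x′ ℤ.+ y ℤ.* y′ ℤ.+ z ℤ.* z′
    in det (dot a b c a′ d′ g′) (dot a b c b′ e′ h′) (dot a b c c′ f′ i′)
           (dot d e f a′ d′ g′) (dot d e f b′ e′ h′) (dot d e f c′ f′ i′)
           (dot g h i a′ d′ g′) (dot g h i b′ e′ h′) (dot g h i c′ f′ i′)
       ≡ det a b c d e f g h i ℤ.* det a′ b′ c′ d′ e′ f′ g′ h′ i′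
  identity = solve-∀

det3-adj : ∀ A → det3 (adj A) ≡ det3 A ℤ.* det3 A
det3-adj A = identity (A i0 i0) (A i0 i1) (A i0 i2) (A i1 i0) (A i1 i1) (A i1 i2) (A i2 i0) (A i2 i1) (A i2 i2)
  where
  identity : ∀ a b c d e f g h i →
    let det = λ a b c d e f g h i →
          a ℤ.* (e ℤ.* i ℤ.- f ℤ.* h) ℤ.- b ℤ.* (d ℤ.* i ℤ.- f ℤ.* g) ℤ.+ c ℤ.* (d ℤ.* h ℤ.- e ℤ.* g)
    in det (e ℤ.* i ℤ.- f ℤ.* h) (h ℤ.* c ℤ.- i ℤ.* b) (b ℤ.* f ℤ.- c ℤ.* e)
           (f ℤ.* g ℤ.- d ℤ.* i) (i ℤ.* a ℤ.- g ℤ.* c) (c ℤ.* d ℤ.- a ℤ.* f)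
           (d ℤ.* h ℤ.- e ℤ.* g) (g ℤ.* b ℤ.- h ℤ.* a) (a ℤ.* e ℤ.- b ℤ.* d)
       ≡ det a b c d e f g h i ℤ.* det a b c d e f g h i
  identity = solve-∀

det3-scaleM : ∀ c A → det3 (scaleM c A) ≡ c ℤ.* c ℤ.* c ℤ.* det3 A
det3-scaleM c A = identity c (A i0 i0) (A i0 i1) (A i0 i2) (A i1 i0) (A i1 i1) (A i1 i2) (A i2 i0) (A i2 i1) (A i2 i2)
  where
  identity : ∀ k a b c d e f g h i →
    let det = λ a b c d e f g h i →
          a ℤ.* (e ℤ.* i ℤ.- f ℤ.* h) ℤ.- b ℤ.* (d ℤ.* i ℤ.- f ℤ.* g) ℤ.+ c ℤ.* (d ℤ.* h ℤ.- e ℤ.* g)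
    in det (k ℤ.* a) (k ℤ.* b) (k ℤ.* c) (k ℤ.* d) (k ℤ.* e) (k ℤ.* f) (k ℤ.* g) (k ℤ.* h) (k ℤ.* i)
       ≡ k ℤ.* k ℤ.* k ℤ.* det a b c d e f g h i
  identity = solve-∀

det3-updateAt-1M : ∀ k (f : Vec3 → Vec3) → det3 (updateAt 1M k f) ≡ f (1M k) k
det3-updateAt-1M zero             f = identity (f (1M i0) i0) (f (1M i0) i1) (f (1M i0) i2)
  where
  identity : ∀ a b c → a ℤ.* 1ℤ ℤ.- b ℤ.* 0ℤ ℤ.+ c ℤ.* 0ℤ ≡ a
  identity = solve-∀
det3-updateAt-1M (suc zero)       f = identity (f (1M i1) i0) (f (1M i1) i1) (f (1M i1) i2)
  where
  identity : ∀ a b c →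
    1ℤ ℤ.* (b ℤ.* 1ℤ ℤ.- c ℤ.* 0ℤ) ℤ.- 0ℤ ℤ.* (a ℤ.* 1ℤ ℤ.- c ℤ.* 0ℤ) ℤ.+ 0ℤ ℤ.* (a ℤ.* 0ℤ ℤ.- b ℤ.* 0ℤ) ≡ b
  identity = solve-∀
det3-updateAt-1M (suc (suc zero)) f = identity (f (1M i2) i0) (f (1M i2) i1) (f (1M i2) i2)
  where
  identity : ∀ a b c →
    1ℤ ℤ.* (1ℤ ℤ.* c ℤ.- 0ℤ ℤ.* b) ℤ.- 0ℤ ℤ.* (0ℤ ℤ.* c ℤ.- 0ℤ ℤ.* a) ℤ.+ 0ℤ ℤ.* (0ℤ ℤ.* b ℤ.- 1ℤ ℤ.* a) ≡ c
  identity = solve-∀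

-- Vectors enter the matrix identities as matrices all of whose columns are equal.
asColumn : Vec3 → Mat3
asColumn x i _ = x i

infixr 7 _·ᵥ_
_·ᵥ_ : Mat3 → Vec3 → Vec3
(A ·ᵥ x) i = dot (A i) x

qform-⟦asColumn⟧ : ∀ G x i j → qform G x ≡ (G ⟦ asColumn x ⟧) i j
qform-⟦asColumn⟧ G x i j = sum3-cong λ k →
  trans (sum3-cong (λ l → ℤ.*-assoc (x k) (G k l) (x l))) (sym (sum3-*ˡ (x k) (λ l → G k l ℤ.* x l)))

qform-cong : ∀ {G G′} x → G ≈ G′ → qform G x ≡ qform G′ x
qform-cong {G} {G′} x G≈G′ =
  trans (qform-⟦asColumn⟧ G x i0 i0) (trans (⟦⟧-congˡ (asColumn x) G≈G′ i0 i0) (sym (qform-⟦asColumn⟧ G′ x i0 i0)))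

qform-scaleM : ∀ c G x → qform (scaleM c G) x ≡ c ℤ.* qform G x
qform-scaleM c G x = begin
  qform (scaleM c G) x                 ≡⟨ qform-⟦asColumn⟧ (scaleM c G) x i0 i0 ⟩
  (scaleM c G ⟦ asColumn x ⟧) i0 i0    ≡⟨ ⟦⟧-scaleˡ c G (asColumn x) i0 i0 ⟩
  c ℤ.* (G ⟦ asColumn x ⟧) i0 i0       ≡⟨ cong (c ℤ.*_) (sym (qform-⟦asColumn⟧ G x i0 i0)) ⟩
  c ℤ.* qform G x                      ∎
  where open ≡-Reasoning

qform-⟦⟧ : ∀ G A x → qform (G ⟦ A ⟧) x ≡ qform G (A ·ᵥ x)
qform-⟦⟧ G A x = begin
  qform (G ⟦ A ⟧) x                   ≡⟨ qform-⟦asColumn⟧ (G ⟦ A ⟧) x i0 i0 ⟩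
  (G ⟦ A ⟧ ⟦ asColumn x ⟧) i0 i0      ≡⟨ sym (⟦⟧-⊗ G A (asColumn x) i0 i0) ⟩
  (G ⟦ A ⊗ asColumn x ⟧) i0 i0        ≡⟨ sym (qform-⟦asColumn⟧ G (A ·ᵥ x) i0 i0) ⟩
  qform G (A ·ᵥ x)                    ∎
  where open ≡-Reasoning

⟦⟧-diagonal : ∀ G A i → (G ⟦ A ⟧) i i ≡ qform G (column A i)
⟦⟧-diagonal G A i = sym (qform-⟦asColumn⟧ G (column A i) i i)

qform-expand : ∀ G x → qform G x ≡
  G i0 i0 ℤ.* (x i0 ℤ.* x i0) ℤ.+ G i1 i1 ℤ.* (x i1 ℤ.* x i1) ℤ.+ G i2 i2 ℤ.* (x i2 ℤ.* x i2)
  ℤ.+ (G i0 i1 ℤ.+ G i1 i0) ℤ.* (x i0 ℤ.* x i1) ℤ.+ (G i0 i2 ℤ.+ G i2 i0) ℤ.* (x i0 ℤ.* x i2)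
  ℤ.+ (G i1 i2 ℤ.+ G i2 i1) ℤ.* (x i1 ℤ.* x i2)
qform-expand G x = identity (G i0 i0) (G i0 i1) (G i0 i2) (G i1 i0) (G i1 i1) (G i1 i2) (G i2 i0) (G i2 i1) (G i2 i2)
                            (x i0) (x i1) (x i2)
  where
  identity : ∀ a b c d e f g h i x y z →
    (x ℤ.* a ℤ.* x ℤ.+ x ℤ.* b ℤ.* y ℤ.+ x ℤ.* c ℤ.* z) ℤ.+ (y ℤ.* d ℤ.* x ℤ.+ y ℤ.* e ℤ.* y ℤ.+ y ℤ.* f ℤ.* z)
      ℤ.+ (z ℤ.* g ℤ.* x ℤ.+ z ℤ.* h ℤ.* y ℤ.+ z ℤ.* i ℤ.* z)
    ≡ a ℤ.* (x ℤ.* x) ℤ.+ e ℤ.* (y ℤ.* y) ℤ.+ i ℤ.* (z ℤ.* z)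
      ℤ.+ (b ℤ.+ d) ℤ.* (x ℤ.* y) ℤ.+ (c ℤ.+ g) ℤ.* (x ℤ.* z) ℤ.+ (f ℤ.+ h) ℤ.* (y ℤ.* z)
  identity = solve-∀

even-qform : ∀ L x → + 2 ∣ qform (gram2 L) x
even-qform L x = subst (+ 2 ∣_) (sym (qform-expand G x))
  (diagonal i0 +∣ diagonal i1 +∣ diagonal i2 +∣ off-diagonal i0 i1 +∣ off-diagonal i0 i2 +∣ off-diagonal i1 i2)
  where
  G = gram2 L
  infixl 6 _+∣_
  _+∣_ = ∣m∣n⇒∣m+n

  diagonal : ∀ i → + 2 ∣ G i i ℤ.* (x i ℤ.* x i)
  diagonal i = ∣m⇒∣m*n (x i ℤ.* x i) (∣ᵤ⇒∣ {+ 2} {G i i} (evenDiag L i))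

  double : ∀ a → a ℤ.+ a ≡ a ℤ.* + 2
  double = solve-∀

  off-diagonal : ∀ i j → + 2 ∣ (G i j ℤ.+ G j i) ℤ.* (x i ℤ.* x j)
  off-diagonal i j =
    ∣m⇒∣m*n (x i ℤ.* x j) (divides (G i j) (trans (cong (ℤ._+_ (G i j)) (symm L j i)) (double (G i j))))

even-⟦⟧-diagonal : ∀ L A i → + 2 ∣ (gram2 L ⟦ A ⟧) i i
even-⟦⟧-diagonal L A i = subst (+ 2 ∣_) (sym (⟦⟧-diagonal (gram2 L) A i)) (even-qform L (column A i))

·ᵥ-injective : ∀ A {x} → det3 A ≢ 0ℤ → (∀ i → (A ·ᵥ x) i ≡ 0ℤ) → ∀ i → x i ≡ 0ℤ
·ᵥ-injective A {x} det≢0 Ax≡0 i = fromInj₂ (λ det≡0 → ⊥-elim (det≢0 det≡0)) (ℤ.i*j≡0⇒i≡0∨j≡0 (det3 A) det*x≡0)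
  where
  adj-A-inverts-A : adj A ⊗ (A ⊗ asColumn x) ≈ scaleM (det3 A) (asColumn x)
  adj-A-inverts-A = begin
    adj A ⊗ (A ⊗ asColumn x)           ≈⟨ ≈-sym (⊗-assoc (adj A) A (asColumn x)) ⟩
    (adj A ⊗ A) ⊗ asColumn x           ≈⟨ ⊗-congˡ (asColumn x) (adj-⊗ A) ⟩
    scaleM (det3 A) 1M ⊗ asColumn x    ≈⟨ scaleM-⊗ (det3 A) 1M (asColumn x) ⟩
    scaleM (det3 A) (1M ⊗ asColumn x)  ≈⟨ scaleM-cong (det3 A) (⊗-identityˡ (asColumn x)) ⟩
    scaleM (det3 A) (asColumn x)       ∎
    where open ≈-Reasoning

  det*x≡0 : det3 A ℤ.* x i ≡ 0ℤ
  det*x≡0 = trans (sym (adj-A-inverts-A i i0))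
                  (sum3-cong (λ k → trans (cong (adj A i k ℤ.*_) (Ax≡0 k)) (ℤ.*-zeroʳ (adj A i k))))

prime∤⇒coprime : ∀ {p n} → Prime p → ¬ p ℕ.∣ n → Coprime p n
prime∤⇒coprime p-prime p∤n (d∣p , d∣n) with prime⇒irreducible p-prime d∣p
... | inj₁ d≡1 = d≡1
... | inj₂ refl = ⊥-elim (p∤n d∣n)

squarefree⇒prime∤cofactor : ∀ {p q} → SquareFree (p * q) → Prime p → ¬ p ℕ.∣ q
squarefree⇒prime∤cofactor {p} squarefree p-prime p∣q =
  ¬prime[1] (subst Prime (squarefree p (ℕ.*-monoʳ-∣ p p∣q)) p-prime)

pos-Bézout : ∀ a b c d → 1 ℕ.+ a * b ≡ c * d → 1ℤ ℤ.+ + a ℤ.* + b ≡ + c ℤ.* + d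
pos-Bézout a b c d eq =
  trans (cong (ℤ._+_ 1ℤ) (sym (ℤ.pos-* a b))) (trans (sym (ℤ.pos-+ 1 (a * b))) (trans (cong +_ eq) (ℤ.pos-* c d)))

inverse-mod-ℕ : ∀ {p n} → Coprime p n → ∃ λ v → + p ∣ 1ℤ ℤ.- v ℤ.* + n
inverse-mod-ℕ {p} {n} coprime with coprime-Bézout coprime
... | Bézout.+- x y eq = ℤ.- + y , divides (+ x) (trans (identity (+ y) (+ n)) (pos-Bézout y n x p eq))
  where
  identity : ∀ a b → 1ℤ ℤ.- ℤ.- a ℤ.* b ≡ 1ℤ ℤ.+ a ℤ.* b
  identity = solve-∀
... | Bézout.-+ x y eq =
  + y , divides (ℤ.- + x) (trans (cong (ℤ._-_ 1ℤ) (sym (pos-Bézout x p y n eq))) (identity (+ x) (+ p)))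
  where
  identity : ∀ a b → 1ℤ ℤ.- (1ℤ ℤ.+ a ℤ.* b) ≡ ℤ.- a ℤ.* b
  identity = solve-∀

inverse-mod : ∀ {p} w → Coprime p ∣ w ∣ → ∃ λ u → + p ∣ 1ℤ ℤ.- u ℤ.* w
inverse-mod {p} w coprime with inverse-mod-ℕ coprime | ℤ.+∣i∣≡i⊎+∣i∣≡-i w
... | v , p∣1-v∣w∣ | inj₁ ∣w∣≡w  = v , subst (λ w′ → + p ∣ 1ℤ ℤ.- v ℤ.* w′) ∣w∣≡w p∣1-v∣w∣
... | v , p∣1-v∣w∣ | inj₂ ∣w∣≡-w = ℤ.- v ,
  subst (λ x → + p ∣ 1ℤ ℤ.- x) (negate v w) (subst (λ w′ → + p ∣ 1ℤ ℤ.- v ℤ.* w′) ∣w∣≡-w p∣1-v∣w∣)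
  where
  negate : ∀ a b → a ℤ.* ℤ.- b ≡ ℤ.- a ℤ.* b
  negate = solve-∀

square-abs : ∀ i → i ℤ.* i ≡ + ∣ i ∣ ℤ.* + ∣ i ∣
square-abs i with ℤ.+∣i∣≡i⊎+∣i∣≡-i i
... | inj₁ ∣i∣≡i  = cong (λ x → x ℤ.* x) (sym ∣i∣≡i)
... | inj₂ ∣i∣≡-i = trans (identity i) (cong (λ x → x ℤ.* x) (sym ∣i∣≡-i))
  where
  identity : ∀ a → a ℤ.* a ≡ ℤ.- a ℤ.* ℤ.- a
  identity = solve-∀

-- Splitting off a factor of determinant p

scaleRow : Fin 3 → ℤ → Mat3 → Mat3
scaleRow k c A = updateAt A k (λ row j → c ℤ.* row j)

det3-scaleRow-1M : ∀ k c → det3 (scaleRow k c 1M) ≡ c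
det3-scaleRow-1M k c =
  trans (det3-updateAt-1M k (λ row j → c ℤ.* row j)) (trans (cong (ℤ._*_ c) (1M-diagonal k)) (ℤ.*-identityʳ c))

scaleRow-1M-⊗-updateAt : ∀ k c A (m : Vec3) → (∀ j → c ℤ.* m j ≡ A k j) →
  scaleRow k c 1M ⊗ updateAt A k (λ _ → m) ≈ A
scaleRow-1M-⊗-updateAt k c A m cm≡Aₖ i j with i ≟ᶠ k
... | yes refl = begin
  dot (scaleRow i c 1M i) (column U j)       ≡⟨ cong (λ row → dot row (column U j)) (updateAt-updates i 1M) ⟩
  dot (λ l → c ℤ.* 1M i l) (column U j)      ≡⟨ sum3-cong (λ l → ℤ.*-assoc c (1M i l) (U l j)) ⟩
  sum3 (λ l → c ℤ.* (1M i l ℤ.* U l j))      ≡⟨ sum3-*ˡ c (λ l → 1M i l ℤ.* U l j) ⟨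
  c ℤ.* dot (1M i) (column U j)              ≡⟨ cong (ℤ._*_ c) (dot-1M i (column U j)) ⟩
  c ℤ.* U i j                                ≡⟨ cong (λ row → c ℤ.* row j) (updateAt-updates i A) ⟩
  c ℤ.* m j                                  ≡⟨ cm≡Aₖ j ⟩
  A i j                                      ∎
  where
  open ≡-Reasoning
  U = updateAt A i (λ _ → m)
... | no i≢k = begin
  dot (scaleRow k c 1M i) (column U j)       ≡⟨ cong (λ row → dot row (column U j)) (updateAt-minimal i k 1M i≢k) ⟩
  dot (1M i) (column U j)                    ≡⟨ dot-1M i (column U j) ⟩
  U i j                                      ≡⟨ cong (λ row → row j) (updateAt-minimal i k A i≢k) ⟩
  A i j                                      ∎
  where
  open ≡-Reasoning
  U = updateAt A k (λ _ → m)

-- E is the identity with row k replaced by z, so det E = 1 and row k of E ⊗ T is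
-- divisible by c.  Dividing that row by c writes E ⊗ T = D ⊗ U with D the identity
-- scaled by c in row k, whence T = (adj E ⊗ D) ⊗ U.
factor-through-row : ∀ c T k (z : Vec3) → z k ≡ 1ℤ → (∀ j → c ∣ dot z (column T j)) →
  ∃₂ λ S U → S ⊗ U ≈ T × det3 S ≡ c
factor-through-row c T k z zₖ≡1 c∣zT = adj E ⊗ D , U , S⊗U≈T , det-S≡c
  where
  E = updateAt 1M k (λ _ → z)
  D = scaleRow k c 1M

  m : Vec3
  m j = quotient (c∣zT j)

  U = updateAt (E ⊗ T) k (λ _ → m)

  det-E≡1 : det3 E ≡ 1ℤ
  det-E≡1 = trans (det3-updateAt-1M k (λ _ → z)) zₖ≡1

  D⊗U≈E⊗T : D ⊗ U ≈ E ⊗ T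
  D⊗U≈E⊗T = scaleRow-1M-⊗-updateAt k c (E ⊗ T) m λ j →
    trans (ℤ.*-comm c (m j))
          (sym (trans (cong (λ row → dot row (column T j)) (updateAt-updates k 1M)) (_∣_.equality (c∣zT j))))

  S⊗U≈T : (adj E ⊗ D) ⊗ U ≈ T
  S⊗U≈T = begin
    (adj E ⊗ D) ⊗ U              ≈⟨ ⊗-assoc (adj E) D U ⟩
    adj E ⊗ (D ⊗ U)              ≈⟨ ⊗-congʳ (adj E) D⊗U≈E⊗T ⟩
    adj E ⊗ (E ⊗ T)              ≈⟨ ⊗-assoc (adj E) E T ⟨
    (adj E ⊗ E) ⊗ T              ≈⟨ ⊗-congˡ T (adj-⊗ E) ⟩
    scaleM (det3 E) 1M ⊗ T       ≈⟨ scaleM-⊗ (det3 E) 1M T ⟩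
    scaleM (det3 E) (1M ⊗ T)     ≈⟨ scaleM-cong (det3 E) (⊗-identityˡ T) ⟩
    scaleM (det3 E) T            ≈⟨ (λ i j → trans (cong (ℤ._* T i j) det-E≡1) (ℤ.*-identityˡ (T i j))) ⟩
    T                            ∎
    where open ≈-Reasoning

  det-S≡c : det3 (adj E ⊗ D) ≡ c
  det-S≡c = begin
    det3 (adj E ⊗ D)             ≡⟨ det3-⊗ (adj E) D ⟩
    det3 (adj E) ℤ.* det3 D      ≡⟨ cong₂ ℤ._*_ (trans (det3-adj E) (cong₂ ℤ._*_ det-E≡1 det-E≡1))
                                                (det3-scaleRow-1M k c) ⟩
    1ℤ ℤ.* c                     ≡⟨ ℤ.*-identityˡ c ⟩
    c                            ∎
    where open ≡-Reasoning

∣det3⇒∣adj⊗ : ∀ {c} T → c ∣ det3 T → ∀ r j → c ∣ (adj T ⊗ T) r j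
∣det3⇒∣adj⊗ T c∣det r j = subst (_ ∣_) (sym (adj-⊗ T r j)) (∣m⇒∣m*n (1M r j) c∣det)

record Factorisation (T : Mat3) (p q : ℕ) : Set where
  field
    S U     : Mat3
    S⊗U≈T   : S ⊗ U ≈ T
    ∣det-S∣ : ∣ det3 S ∣ ≡ p
    ∣det-U∣ : ∣ det3 U ∣ ≡ q

module _ {p q : ℕ} (p-prime : Prime p) (p∤q : ¬ p ℕ.∣ q) where
  private instance
    p≢0 : ℕ.NonZero p
    p≢0 = prime⇒nonZero p-prime

  -- Otherwise p³ would divide det (adj T) = (det T)² = p²q², forcing p ∣ q.
  adj-not-divisible : ∀ T → ∣ det3 T ∣ ≡ p * q → ¬ (∀ i j → + p ∣ adj T i j)
  adj-not-divisible T ∣det-T∣ p∣adj = p∤q (reduce (euclidsLemma q q p-prime p∣q²))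
    where
    B : Mat3
    B i j = quotient (p∣adj i j)

    adj≈pB : adj T ≈ scaleM (+ p) B
    adj≈pB i j = trans (_∣_.equality (p∣adj i j)) (ℤ.*-comm (B i j) (+ p))

    det-T² : (p * q) * (p * q) ≡ ∣ det3 B ∣ * (p * p * p)
    det-T² = begin
      (p * q) * (p * q)                       ≡⟨ cong₂ _*_ ∣det-T∣ ∣det-T∣ ⟨
      ∣ det3 T ∣ * ∣ det3 T ∣                  ≡⟨ ℤ.abs-* (det3 T) (det3 T) ⟨
      ∣ det3 T ℤ.* det3 T ∣                   ≡⟨ cong ∣_∣ (det3-adj T) ⟨
      ∣ det3 (adj T) ∣                         ≡⟨ cong ∣_∣ (trans (det3-cong adj≈pB) (det3-scaleM (+ p) B)) ⟩
      ∣ + p ℤ.* + p ℤ.* + p ℤ.* det3 B ∣       ≡⟨ ℤ.abs-* (+ p ℤ.* + p ℤ.* + p) (det3 B) ⟩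
      ∣ + p ℤ.* + p ℤ.* + p ∣ * ∣ det3 B ∣     ≡⟨ cong (_* ∣ det3 B ∣) (trans (ℤ.abs-* (+ p ℤ.* + p) (+ p))
                                                                         (cong (_* p) (ℤ.abs-* (+ p) (+ p)))) ⟩
      p * p * p * ∣ det3 B ∣                   ≡⟨ ℕ.*-comm (p * p * p) ∣ det3 B ∣ ⟩
      ∣ det3 B ∣ * (p * p * p)                 ∎
      where open ≡-Reasoning

    rearrange : ∀ p q → (p * q) * (p * q) ≡ (p * p) * (q * q)
    rearrange = ℕ.solve-∀

    p∣q² : p ℕ.∣ q * q
    p∣q² = ℕ.*-cancelˡ-∣ (p * p) {{ℕ.m*n≢0 p p}}
             (subst (p * p * p ℕ.∣_) (rearrange p q) (ℕ.divides ∣ det3 B ∣ det-T²))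

  adj-pivot : ∀ T → ∣ det3 T ∣ ≡ p * q → ∃₂ λ r k → ¬ + p ∣ adj T r k
  adj-pivot T ∣det-T∣ =
    let r , ¬∀k = ¬∀⟶∃¬ 3 (λ r → ∀ k → + p ∣ adj T r k) (λ r → all? (λ k → + p ∣? adj T r k))
                         (adj-not-divisible T ∣det-T∣)
        k , p∤adj = ¬∀⟶∃¬ 3 (λ k → + p ∣ adj T r k) (λ k → + p ∣? adj T r k) ¬∀k
    in r , k , p∤adj

  normalise-kernel-row : ∀ T (w : Vec3) k → ¬ + p ∣ w k → (∀ j → + p ∣ dot w (column T j)) →
    ∃ λ z → z k ≡ 1ℤ × ∀ j → + p ∣ dot z (column T j)
  normalise-kernel-row T w k p∤wₖ p∣wT with inverse-mod (w k) (prime∤⇒coprime p-prime (λ p∣wₖ → p∤wₖ (∣ᵤ⇒∣ p∣wₖ)))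
  ... | u , p∣1-uwₖ = z , zₖ≡1 , p∣zT
    where
    z : Vec3
    z l = u ℤ.* w l ℤ.+ (1ℤ ℤ.- u ℤ.* w k) ℤ.* 1M k l

    zₖ≡1 : z k ≡ 1ℤ
    zₖ≡1 = trans (cong (λ δ → u ℤ.* w k ℤ.+ (1ℤ ℤ.- u ℤ.* w k) ℤ.* δ) (1M-diagonal k)) (identity (u ℤ.* w k))
      where
      identity : ∀ a → a ℤ.+ (1ℤ ℤ.- a) ℤ.* 1ℤ ≡ 1ℤ
      identity = solve-∀

    p∣zT : ∀ j → + p ∣ dot z (column T j)
    p∣zT j = subst (+ p ∣_) (sym (dot-linear u (1ℤ ℤ.- u ℤ.* w k) w (1M k) (column T j)))
                   (∣m∣n⇒∣m+n (∣n⇒∣m*n u (p∣wT j)) (∣m⇒∣m*n (dot (1M k) (column T j)) p∣1-uwₖ))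

  factorisation : ∀ {T} S U → S ⊗ U ≈ T → det3 S ≡ + p → ∣ det3 T ∣ ≡ p * q → Factorisation T p q
  factorisation {T} S U S⊗U≈T det-S≡p ∣det-T∣ = record
    { S = S ; U = U ; S⊗U≈T = S⊗U≈T
    ; ∣det-S∣ = cong ∣_∣ det-S≡p
    ; ∣det-U∣ = ℕ.*-cancelˡ-≡ ∣ det3 U ∣ q p p∣det-U∣≡pq
    }
    where
    p∣det-U∣≡pq : p * ∣ det3 U ∣ ≡ p * q
    p∣det-U∣≡pq = begin
      p * ∣ det3 U ∣             ≡⟨ cong (λ x → ∣ x ∣ * ∣ det3 U ∣) det-S≡p ⟨
      ∣ det3 S ∣ * ∣ det3 U ∣     ≡⟨ ℤ.abs-* (det3 S) (det3 U) ⟨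
      ∣ det3 S ℤ.* det3 U ∣      ≡⟨ cong ∣_∣ (det3-⊗ S U) ⟨
      ∣ det3 (S ⊗ U) ∣           ≡⟨ cong ∣_∣ (det3-cong S⊗U≈T) ⟩
      ∣ det3 T ∣                 ≡⟨ ∣det-T∣ ⟩
      p * q                      ∎
      where open ≡-Reasoning

  factorise : ∀ T → ∣ det3 T ∣ ≡ p * q → Factorisation T p q
  factorise T ∣det-T∣ =
    let r , k , p∤adj           = adj-pivot T ∣det-T∣
        z , zₖ≡1 , p∣zT         = normalise-kernel-row T (adj T r) k p∤adj (∣det3⇒∣adj⊗ T p∣det-T r)
        S , U , S⊗U≈T , det-S≡p = factor-through-row (+ p) T k z zₖ≡1 p∣zT
    in factorisation S U S⊗U≈T det-S≡p ∣det-T∣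
    where
    p∣det-T : + p ∣ det3 T
    p∣det-T = ∣ᵤ⇒∣ {+ p} {det3 T} (subst (p ℕ.∣_) (sym ∣det-T∣) (ℕ.m∣m*n q))

-- The intermediate lattice

module IntermediateLattice
  (N M : TernaryLattice) {p q : ℕ} (p-prime : Prime p) (p∤q : ¬ p ℕ.∣ q)
  {T : Mat3} (T-iso : gram2 N ⟦ T ⟧ ≈ scaleM (+ (p * q)) (gram2 M)) (F : Factorisation T p q)
  where

  open Factorisation F

  private
    instance
      p≢0 : ℕ.NonZero p
      p≢0 = prime⇒nonZero p-prime

    q≢0 : ℕ.NonZero q
    q≢0 = ℕ.≢-nonZero (λ q≡0 → p∤q (subst (p ℕ.∣_) (sym q≡0) (p ℕ.∣0)))

    coprime : Coprime p q
    coprime = prime∤⇒coprime p-prime p∤q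

    G = gram2 N
    H = gram2 M
    d = det3 U
    P = G ⟦ S ⟧
    X = H ⟦ adj U ⟧

  T⊗adj-U≈dS : T ⊗ adj U ≈ scaleM d S
  T⊗adj-U≈dS = begin
    T ⊗ adj U            ≈⟨ ⊗-congˡ (adj U) S⊗U≈T ⟨
    (S ⊗ U) ⊗ adj U      ≈⟨ ⊗-assoc S U (adj U) ⟩
    S ⊗ (U ⊗ adj U)      ≈⟨ ⊗-congʳ S (⊗-adj U) ⟩
    S ⊗ scaleM d 1M      ≈⟨ ⊗-scaleM d S 1M ⟩
    scaleM d (S ⊗ 1M)    ≈⟨ scaleM-cong d (⊗-identityʳ S) ⟩
    scaleM d S           ∎
    where open ≈-Reasoning

  d²P≈pqX : scaleM (d ℤ.* d) P ≈ scaleM (+ (p * q)) X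
  d²P≈pqX = begin
    scaleM (d ℤ.* d) P               ≈⟨ ⟦⟧-scaleʳ d G S ⟨
    G ⟦ scaleM d S ⟧                 ≈⟨ ⟦⟧-congʳ G T⊗adj-U≈dS ⟨
    G ⟦ T ⊗ adj U ⟧                  ≈⟨ ⟦⟧-⊗ G T (adj U) ⟩
    G ⟦ T ⟧ ⟦ adj U ⟧                ≈⟨ ⟦⟧-congˡ (adj U) T-iso ⟩
    scaleM (+ (p * q)) H ⟦ adj U ⟧   ≈⟨ ⟦⟧-scaleˡ (+ (p * q)) H (adj U) ⟩
    scaleM (+ (p * q)) X             ∎
    where open ≈-Reasoning

  qP≡pX : ∀ i j → + q ℤ.* P i j ≡ + p ℤ.* X i j
  qP≡pX i j = ℤ.*-cancelˡ-≡ (+ q) _ _ {{q≢0}} (begin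
    + q ℤ.* (+ q ℤ.* P i j)    ≡⟨ ℤ.*-assoc (+ q) (+ q) (P i j) ⟨
    + q ℤ.* + q ℤ.* P i j      ≡⟨ cong (ℤ._* P i j) (trans (square-abs d) (cong (λ n → + n ℤ.* + n) ∣det-U∣)) ⟨
    d ℤ.* d ℤ.* P i j          ≡⟨ d²P≈pqX i j ⟩
    + (p * q) ℤ.* X i j        ≡⟨ cong (ℤ._* X i j) (ℤ.pos-* p q) ⟩
    + p ℤ.* + q ℤ.* X i j      ≡⟨ xy∙z≈y∙xz (+ p) (+ q) (X i j) ⟩
    + q ℤ.* (+ p ℤ.* X i j)    ∎)
    where open ≡-Reasoning

  p∣P : ∀ i j → + p ∣ P i j
  p∣P i j = ∣ᵤ⇒∣ {+ p} {P i j} (coprime-divisor coprime (subst (p ℕ.∣_) ∣pX∣≡q∣P∣ (ℕ.m∣m*n ∣ X i j ∣)))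
    where
    ∣pX∣≡q∣P∣ : p * ∣ X i j ∣ ≡ q * ∣ P i j ∣
    ∣pX∣≡q∣P∣ = trans (sym (ℤ.abs-* (+ p) (X i j))) (trans (cong ∣_∣ (sym (qP≡pX i j))) (ℤ.abs-* (+ q) (P i j)))

  C : Mat3
  C i j = quotient (p∣P i j)

  P≈pC : P ≈ scaleM (+ p) C
  P≈pC i j = trans (_∣_.equality (p∣P i j)) (ℤ.*-comm (C i j) (+ p))

  X≈qC : X ≈ scaleM (+ q) C
  X≈qC i j = ℤ.*-cancelˡ-≡ (+ p) _ _
    (trans (sym (qP≡pX i j)) (trans (cong (ℤ._*_ (+ q)) (P≈pC i j)) (x∙yz≈y∙xz (+ q) (+ p) (C i j))))

  C-symm : ∀ i j → C i j ≡ C j i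
  C-symm i j = ℤ.*-cancelˡ-≡ (+ p) _ _ (trans (sym (P≈pC i j)) (trans P-symm (P≈pC j i)))
    where
    P-symm : P i j ≡ P j i
    P-symm = sym (trans (transpose-⟦⟧ G S i j) (⟦⟧-congˡ S (λ i j → symm N j i) i j))

  -- P and X have even diagonals and are p C and q C; as p and q are coprime, one of them is odd.
  C-evenDiag : ∀ i → 2 ℕ.∣ ∣ C i i ∣
  C-evenDiag i = coprime-factors coprime
    ( even-multiple p (P≈pC i i) (even-⟦⟧-diagonal N S i)
    , even-multiple q (X≈qC i i) (even-⟦⟧-diagonal M (adj U) i) )
    where
    even-multiple : ∀ a {x} → x ≡ + a ℤ.* C i i → + 2 ∣ x → 2 ℕ.∣ a * ∣ C i i ∣
    even-multiple a x≡aC 2∣x = subst (2 ℕ.∣_) (trans (cong ∣_∣ x≡aC) (ℤ.abs-* (+ a) (C i i))) (∣⇒∣ᵤ 2∣x)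

  C-posDef : ∀ x → ¬ (∀ i → x i ≡ 0ℤ) → 0ℤ ℤ.< qform C x
  C-posDef x x≢0 =
    ℤ.*-cancelˡ-<-nonNeg (+ p) (subst₂ ℤ._<_ (sym (ℤ.*-zeroʳ (+ p))) G[Sx]≡p·C[x] (posDef N (S ·ᵥ x) Sx≢0))
    where
    det-S≢0 : det3 S ≢ 0ℤ
    det-S≢0 det≡0 = ℕ.≢-nonZero⁻¹ p (trans (sym ∣det-S∣) (cong ∣_∣ det≡0))

    Sx≢0 : ¬ (∀ i → (S ·ᵥ x) i ≡ 0ℤ)
    Sx≢0 Sx≡0 = x≢0 (·ᵥ-injective S det-S≢0 Sx≡0)

    G[Sx]≡p·C[x] : qform G (S ·ᵥ x) ≡ + p ℤ.* qform C x
    G[Sx]≡p·C[x] = trans (sym (qform-⟦⟧ G S x)) (trans (qform-cong x P≈pC) (qform-scaleM (+ p) C x))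

  Np : TernaryLattice
  Np = record { gram2 = C ; symm = C-symm ; evenDiag = C-evenDiag ; posDef = C-posDef }

  N→Np : RepPairByScaling N Np p
  N→Np = S , P≈pC , ∣det-S∣

  Np→M : RepPairByScaling Np M q
  Np→M = U , (λ i j → ℤ.*-cancelˡ-≡ (+ p) _ _ (p·C⟦U⟧≈p·qH i j)) , ∣det-U∣
    where
    p·C⟦U⟧≈p·qH : scaleM (+ p) (C ⟦ U ⟧) ≈ scaleM (+ p) (scaleM (+ q) H)
    p·C⟦U⟧≈p·qH = begin
      scaleM (+ p) (C ⟦ U ⟧)          ≈⟨ ⟦⟧-scaleˡ (+ p) C U ⟨
      scaleM (+ p) C ⟦ U ⟧            ≈⟨ ⟦⟧-congˡ U P≈pC ⟨
      G ⟦ S ⟧ ⟦ U ⟧                   ≈⟨ ⟦⟧-⊗ G S U ⟨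
      G ⟦ S ⊗ U ⟧                     ≈⟨ ⟦⟧-congʳ G S⊗U≈T ⟩
      G ⟦ T ⟧                         ≈⟨ T-iso ⟩
      scaleM (+ (p * q)) H            ≈⟨ (λ i j → cong (ℤ._* H i j) (ℤ.pos-* p q)) ⟩
      scaleM (+ p ℤ.* + q) H          ≈⟨ scaleM-scaleM (+ p) (+ q) H ⟨
      scaleM (+ p) (scaleM (+ q) H)   ∎
      where open ≈-Reasoning

-- The hypothesis n > 0 is redundant: p ∤ q already rules out n = 0.
lemma5p2 : (n : ℕ) → n > 0 → SquareFree n →
    (N M : TernaryLattice) → RepPairByScaling N M n →
    (p q : ℕ) → Prime p → n ≡ p * q →
    Σ TernaryLattice λ Np → RepPairByScaling N Np p × RepPairByScaling Np M q
lemma5p2 n _ n-squarefree N M (T , T-iso , ∣det-T∣) p q p-prime refl = Np , N→Np , Np→M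
  where
  p∤q = squarefree⇒prime∤cofactor n-squarefree p-prime
  open IntermediateLattice N M p-prime p∤q T-iso (factorise p-prime p∤q T ∣det-T∣)
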